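{- Let $T$ be a tree with rotor configuration $r$, and let $T_1,\dots,T_b$ be its principal branches with restricted configurations $r_1,\dots,r_b$. Let $\ell:=\liminf_{n\to\infty}E_n(T,r)/n$ and $\ell_i:=\liminf_{n\to\infty}E_n(T_i,r_i)/n$ for $i=1,\dots,b$. Then $$\ell\ge1-\frac{1}{1+\sum_{i=1}^b\ell_i}.$$
   Context: A tree $T$ is an infinite tree with all vertex degrees finite and a distinguished root $\rho$ of degree $1$; $V_\rho$ is its set of non-root vertices. For $v\in V_\rho$, $v^{(0)}$ is the parent and $v^{(1)},\dots,v^{(b(v))}$ the children of $v$, with cyclic order of neighbours $v^{(0)},\dots,v^{(b(v))}$. A rotor configuration is a map $r$ on $V_\rho$ with $0\le r(v)\le b(v)$, meaning the rotor at $v$ points to $v^{(r(v))}$; the rotor at $\rho$ always points to its only child. Rotor walk: at each step the rotor at the particle's current vertex is advanced to the next neighbour in the cyclic order, and the particle moves there. Particles are started one after another at $\rho$: each performs rotor walk until it first returns to $\rho$, or else never returns (it escapes to infinity); the next particle starts with the rotors left by the previous ones. $E_n(T,r)$ is the number of the first $n$ particles that escape. The base $o$ is the child of $\rho$, with $b=b(o)$ children. For $v\in V_\rho$, the subtree $T_v$ is the subgraph induced by $v^{(0)}$, $v$ and all descendants of $v$, rooted at $v^{(0)}$, with inherited cyclic orders and restricted configuration $r_v$. The principal branches are $T_i=T_{o^{(i)}}$, $r_i=r_{o^{(i)}}$. -}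

module Defs where

open import Data.Nat as ℕ using (ℕ; zero; suc)
open import Data.Nat.DivMod using (_%_)
open import Data.List using (List; []; _∷_; _++_; length)
open import Data.List.Properties using (≡-dec)
open import Data.Bool using (Bool; true; false; if_then_else_)
open import Data.Product using (Σ; _×_; _,_; ∃; ∃-syntax)
open import Data.Unit using (⊤)
open import Data.Empty using (⊥)
open import Data.Integer using (+_)
open import Relation.Nullary using (¬_; yes; no)
open import Relation.Binary.PropositionalEquality using (_≡_; refl)
open import Data.Rational as ℚ using (ℚ; 0ℚ; 1ℚ; _-_; _+_; 1/_; _/_)
import Data.Rational.Properties as ℚP

-- A non-root vertex is addressed by the list of child labels on
-- the path from the base o, stored in REVERSE order (head = last step).
-- The base o is [], its children are (i ∷ []) for 1 ≤ i ≤ b [], and the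
-- children of a vertex a are (k ∷ a) for 1 ≤ k ≤ b a.  The root ρ is a
-- separate position.  A tree is given by its branching function b
-- (number of children of each vertex); values at non-vertices are
-- irrelevant.

Addr : Set
Addr = List ℕ

Tree : Set
Tree = Addr → ℕ

Valid : Tree → Addr → Set
Valid b []      = ⊤
Valid b (k ∷ a) = Valid b a × (1 ℕ.≤ k × k ℕ.≤ b a)

Infinite : Tree → Set
Infinite b = ∀ d → ∃[ a ] (Valid b a × length a ≡ d)

-- rotor configurations: r a ∈ {0,…,b a}; 0 = parent, k = k-th child
Config : Set
Config = Addr → ℕ

IsConfig : Tree → Config → Set
IsConfig b r = ∀ a → Valid b a → r a ℕ.≤ b a

data Pos : Set where
  ρ  : Pos
  at : Addr → Pos

parentOf : Addr → Pos
parentOf []      = ρ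
parentOf (_ ∷ a) = at a

nbr : Addr → ℕ → Pos
nbr a zero    = parentOf a
nbr a (suc j) = at (suc j ∷ a)

update : Config → Addr → ℕ → Config
update r a k a' with ≡-dec ℕ._≟_ a' a
... | yes _ = k
... | no  _ = r a'

step : Tree → Config × Pos → Config × Pos
step b (r , ρ)    = r , at []
step b (r , at a) = update r a k , nbr a k
  where k = suc (r a) % suc (b a)

walk : Tree → Config → ℕ → Config × Pos
walk b r zero    = r , ρ
walk b r (suc k) = step b (walk b r k)

cfg : Config × Pos → Config
cfg (r , _) = r

pos : Config × Pos → Pos
pos (_ , p) = p

-- Particle b r r' e:
-- either it returns to ρ (e = false) and r' is the configuration at
-- its first return time, or it never returns (e = true) and r' is the
-- configuration it leaves behind, i.e. the pointwise eventual value of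
-- the rotors.
data Particle (b : Tree) (r : Config) : Config → Bool → Set where
  returns : ∀ k → 0 ℕ.< k → pos (walk b r k) ≡ ρ
          → (∀ j → 0 ℕ.< j → j ℕ.< k → ¬ pos (walk b r j) ≡ ρ)
          → Particle b r (cfg (walk b r k)) false
  escapes : ∀ r' → (∀ k → 0 ℕ.< k → ¬ pos (walk b r k) ≡ ρ)
          → (∀ a → ∃[ K ] ∀ k → K ℕ.≤ k → cfg (walk b r k) a ≡ r' a)
          → Particle b r r' true

-- Run b r n r' e : after releasing n particles one after another from
-- the initial configuration r, the configuration is r' and e of them
-- escaped.  Thus E_n(T,r) = e.
data Run (b : Tree) (r : Config) : ℕ → Config → ℕ → Set where
  run0 : Run b r 0 r 0
  runS : ∀ {n r' r'' e esc} → Run b r n r' e → Particle b r' r'' esc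
       → Run b r (suc n) r'' (if esc then suc e else e)

-- Principal branches T_i = T_{o^(i)} with restricted configurations.
-- A vertex a of T_i (addresses relative to the new base o^(i))
-- corresponds to the vertex a ++ [i] of T.

branchTree : Tree → ℕ → Tree
branchTree b i a = b (a ++ (i ∷ []))

branchConfig : Config → ℕ → Config
branchConfig r i a = r (a ++ (i ∷ []))

-- liminf_{n→∞} E_n(T,r)/n ≥ q, stated for a rational q by the
-- definition of liminf: for every ε > 0, eventually E_n/n ≥ q - ε.

LiminfAtLeast : Tree → Config → ℚ → Set
LiminfAtLeast b r q =
  ∀ (ε : ℚ) → 0ℚ ℚ.< ε →
    ∃[ N ] ∀ n → N ℕ.≤ n → ∀ r' e → Run b r (suc n) r' e →
      q - ε ℚ.≤ (+ e) / (suc n)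

sumTo : ℕ → (ℕ → ℚ) → ℚ
sumTo zero    q = 0ℚ
sumTo (suc m) q = sumTo m q + q (suc m)

sumTo-nonneg : ∀ m (q : ℕ → ℚ) → (∀ i → 0ℚ ℚ.≤ q i) → 0ℚ ℚ.≤ sumTo m q
sumTo-nonneg zero    q h = ℚP.≤-refl
sumTo-nonneg (suc m) q h = ℚP.+-mono-≤ (sumTo-nonneg m q h) (h (suc m))

bound : (S : ℚ) → 0ℚ ℚ.≤ S → ℚ
bound S h = 1ℚ - (1/ (1ℚ + S)) {{ℚP.pos⇒nonZero (1ℚ + S) {{posS}}}}
  where
  posS : ℚ.Positive (1ℚ + S)
  posS = ℚP.pos+nonNeg⇒pos 1ℚ S {{ℚ.nonNegative h}}

-- Every particle released at ρ steps to the base o, whose rotor sends it back to ρ or into a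
-- principal branch T_i. Inside T_i the particle performs exactly the rotor walk of the next
-- particle released in T_i from r_i, and it comes back to o or escapes as that particle does.
-- So after n particles E_n(T) = Σ_i E_{n_i}(T_i), where n_i particles entered T_i; as the rotor
-- at o serves ρ, T_1, ..., T_b in turn, n_i ≥ R - 1 for the number R = n - E_n(T) of returns.
-- With E_{n_i}(T_i) ≥ (ℓ_i - δ) n_i for large n_i this gives S·(n - E_n) ≤ E_n + o(n) for
-- S = Σ ℓ_i, that is E_n / n ≥ S / (1 + S) - o(1) = 1 - 1 / (1 + S) - o(1).

module Submission where

open import Defs
open import Data.Nat using (ℕ; _≤_)
open import Data.List using ([])
open import Data.Rational using (ℚ; 0ℚ)
import Data.Rational as ℚ

open import Data.Bool using (true; false; if_then_else_)
open import Data.Empty using (⊥-elim)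
open import Data.List using (_∷_; _∷ʳ_)
open import Data.List.Properties using (≡-dec; ∷ʳ-injective)
open import Data.Nat as ℕ using (zero; suc; _∸_; _<_; z≤n; s≤s)
import Data.Nat.Coprimality as Coprimality
open import Data.Nat.DivMod using (_%_; m%n<n; n%n≡0; m<n⇒m%n≡m)
import Data.Nat.Properties as ℕ
open import Data.Product using (Σ; _×_; _,_; proj₁; proj₂; ∃-syntax)
open import Data.Rational using (mkℚ; 1ℚ; ½; _*_; _-_; -_; _/_; 1/_; *≤*; ↧ₙ_; toℚᵘ)
import Data.Rational.Properties as ℚ
open import Data.Rational.Solver using (module +-*-Solver)
import Data.Rational.Unnormalised as ℚᵘ
open import Data.Sum using (_⊎_; inj₁; inj₂; [_,_]′)
open import Function using (_∘_)
open import Relation.Nullary using (¬_; Dec; yes; no)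
open import Relation.Binary.PropositionalEquality

open +-*-Solver using (solve; _:=_; _:+_; _:-_; _:*_; con)

module RotorWalk where

  open import Data.Nat using (_+_)
  open import Algebra.Properties.CommutativeSemigroup ℕ.+-commutativeSemigroup using (x∙yz≈y∙xz)

  []≢∷ʳ : ∀ (a : Addr) i → [] ≢ a ∷ʳ i
  []≢∷ʳ []      i ()
  []≢∷ʳ (_ ∷ _) i ()

  update-≡ : ∀ r a k → update r a k a ≡ k
  update-≡ r a k with ≡-dec ℕ._≟_ a a
  ... | yes _  = refl
  ... | no a≢a = ⊥-elim (a≢a refl)

  update-≢ : ∀ r a k {a'} → a' ≢ a → update r a k a' ≡ r a'
  update-≢ r a k {a'} a'≢a with ≡-dec ℕ._≟_ a' a
  ... | yes a'≡a = ⊥-elim (a'≢a a'≡a)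
  ... | no  _    = refl

  steps : Tree → Config × Pos → ℕ → Config × Pos
  steps b s zero    = s
  steps b s (suc k) = step b (steps b s k)

  walk-+ : ∀ b r t j → walk b r (t + j) ≡ steps b (walk b r t) j
  walk-+ b r t zero    = cong (walk b r) (ℕ.+-identityʳ t)
  walk-+ b r t (suc j) = trans (cong (walk b r) (ℕ.+-suc t j)) (cong (step b) (walk-+ b r t j))

  advance : ℕ → ℕ → ℕ
  advance m p = suc p % suc m

  advance-cases : ∀ {m p} → p ≤ m → (p ≡ m × advance m p ≡ 0) ⊎ (p < m × advance m p ≡ suc p)
  advance-cases {m} {p} p≤m with ℕ.m≤n⇒m<n∨m≡n p≤m
  ... | inj₁ p<m  = inj₂ (p<m , m<n⇒m%n≡m (s≤s p<m))
  ... | inj₂ refl = inj₁ (refl , n%n≡0 (suc m))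

  advance≤ : ∀ m p → advance m p ≤ m
  advance≤ m p = ℕ.≤-pred (m%n<n (suc p) (suc m))

  advance≡0⇒≡ : ∀ {m p} → p ≤ m → advance m p ≡ 0 → p ≡ m
  advance≡0⇒≡ p≤m adv≡0 with advance-cases p≤m
  ... | inj₁ (p≡m , _)  = p≡m
  ... | inj₂ (_ , adv≡) = ⊥-elim (ℕ.1+n≢0 (trans (sym adv≡) adv≡0))

  advance≡suc⇒≡ : ∀ {m p j} → p ≤ m → advance m p ≡ suc j → p ≡ j
  advance≡suc⇒≡ p≤m adv≡1+j with advance-cases p≤m
  ... | inj₁ (_ , adv≡0) = ⊥-elim (ℕ.1+n≢0 (trans (sym adv≡1+j) adv≡0))
  ... | inj₂ (_ , adv≡)  = ℕ.suc-injective (trans (sym adv≡) adv≡1+j)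

  advance≢ : ∀ {m} p → 1 ≤ m → advance m p ≢ p
  advance≢ {m} p 1≤m adv≡p with advance-cases (subst (_≤ m) adv≡p (advance≤ m p))
  ... | inj₁ (refl , adv≡0) = ℕ.<⇒≢ 1≤m (trans (sym adv≡0) adv≡p)
  ... | inj₂ (_ , adv≡)     = ℕ.1+n≢n (trans (sym adv≡) adv≡p)

  OutsideBranch : ℕ → Addr → Set
  OutsideBranch i x = ∀ a → x ≢ a ∷ʳ i

  UnchangedOutside : ℕ → Config → Config → Set
  UnchangedOutside i C C' = ∀ x → OutsideBranch i x → C' x ≡ C x

  -- A position of T inside T_i and the corresponding position of T_i; the base o of T
  -- corresponds to the root of T_i.
  data BranchPos (i : ℕ) : Pos → Pos → Set where
    inside : ∀ a → BranchPos i (at (a ∷ʳ i)) (at a)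
    base   : BranchPos i (at []) ρ

  BranchPos-≢ρ : ∀ {i p p'} → BranchPos i p p' → p ≢ ρ
  BranchPos-≢ρ (inside a) ()
  BranchPos-≢ρ base       ()

  BranchPos-ρ : ∀ {i p} → BranchPos i p ρ → p ≡ at []
  BranchPos-ρ base = refl

  Simulates : ℕ → Config × Pos → Config × Pos → Set
  Simulates i s s' = cfg s' ≗ branchConfig (cfg s) i × BranchPos i (pos s) (pos s')

  nbr-BranchPos : ∀ i a k → BranchPos i (nbr (a ∷ʳ i) k) (nbr a k)
  nbr-BranchPos i []      zero    = base
  nbr-BranchPos i (_ ∷ a) zero    = inside a
  nbr-BranchPos i a       (suc j) = inside (suc j ∷ a)

  module _ (b : Tree) (i : ℕ) where

    step-simulates : ∀ {C c p p'} → c ≗ branchConfig C i → BranchPos i p p' → p' ≢ ρ →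
                     Simulates i (step b (C , p)) (step (branchTree b i) (c , p')) ×
                     UnchangedOutside i C (cfg (step b (C , p)))
    step-simulates {C} {c} c≗C (inside a) _ = (restricts , moves) , unchanged
      where
      k k' : ℕ
      k  = advance (b (a ∷ʳ i)) (C (a ∷ʳ i))
      k' = advance (b (a ∷ʳ i)) (c a)
      k'≡k : k' ≡ k
      k'≡k = cong (advance (b (a ∷ʳ i))) (c≗C a)
      restricts : update c a k' ≗ branchConfig (update C (a ∷ʳ i) k) i
      restricts a' = by-cases (≡-dec ℕ._≟_ a' a)
        where
        by-cases : Dec (a' ≡ a) → update c a k' a' ≡ update C (a ∷ʳ i) k (a' ∷ʳ i)
        by-cases (yes refl) = trans (update-≡ c a k') (trans k'≡k (sym (update-≡ C (a ∷ʳ i) k)))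
        by-cases (no a'≢a)  = trans (update-≢ c a k' a'≢a)
          (trans (c≗C a') (sym (update-≢ C (a ∷ʳ i) k (a'≢a ∘ proj₁ ∘ ∷ʳ-injective a' a))))
      moves : BranchPos i (nbr (a ∷ʳ i) k) (nbr a k')
      moves rewrite k'≡k = nbr-BranchPos i a k
      unchanged : UnchangedOutside i C (update C (a ∷ʳ i) k)
      unchanged x x∉ = update-≢ C (a ∷ʳ i) k (x∉ a)
    step-simulates c≗C base p'≢ρ = ⊥-elim (p'≢ρ refl)

    steps-simulate : ∀ j {s s'} → Simulates i s s' →
                     (∀ t → t < j → pos (steps (branchTree b i) s' t) ≢ ρ) →
                     Simulates i (steps b s j) (steps (branchTree b i) s' j) ×
                     UnchangedOutside i (cfg s) (cfg (steps b s j))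
    steps-simulate zero    sim _       = sim , λ _ _ → refl
    steps-simulate (suc j) {s} {s'} sim no-root =
      proj₁ next , λ x x∉ → trans (proj₂ next x x∉) (proj₂ ih x x∉)
      where
      ih : Simulates i (steps b s j) (steps (branchTree b i) s' j) × UnchangedOutside i (cfg s) (cfg (steps b s j))
      ih = steps-simulate j sim (λ t t<j → no-root t (ℕ.m<n⇒m<1+n t<j))
      next : Simulates i (steps b s (suc j)) (steps (branchTree b i) s' (suc j)) ×
             UnchangedOutside i (cfg (steps b s j)) (cfg (steps b s (suc j)))
      next = step-simulates (proj₁ (proj₁ ih)) (proj₂ (proj₁ ih)) (no-root j ℕ.≤-refl)

  data FirstHit (P : ℕ → Set) (B : ℕ) : Set where
    hit   : ∀ s → 1 ≤ s → s ≤ B → P s → (∀ s' → 1 ≤ s' → s' < s → ¬ P s') → FirstHit P B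
    noHit : (∀ s → 1 ≤ s → s ≤ B → ¬ P s) → FirstHit P B

  firstHit : ∀ {P : ℕ → Set} → (∀ s → Dec (P s)) → ∀ B → FirstHit P B
  firstHit P? zero = noHit λ s 1≤s s≤0 → ⊥-elim (ℕ.<⇒≱ 1≤s s≤0)
  firstHit P? (suc B) with firstHit P? B
  ... | hit s 1≤s s≤B Ps first = hit s 1≤s (ℕ.m≤n⇒m≤1+n s≤B) Ps first
  ... | noHit none with P? (suc B)
  ...   | yes PB = hit (suc B) (s≤s z≤n) ℕ.≤-refl PB (λ s' 1≤s' s'≤B → none s' 1≤s' (ℕ.≤-pred s'≤B))
  ...   | no ¬PB = noHit λ s 1≤s s≤1+B → [ none s 1≤s ∘ ℕ.≤-pred , (λ { refl → ¬PB }) ]′ (ℕ.m≤n⇒m<n∨m≡n s≤1+B)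

  at≢ρ : ∀ {a} → at a ≢ ρ
  at≢ρ ()

  _≟ρ : ∀ p → Dec (p ≡ ρ)
  ρ    ≟ρ = yes refl
  at _ ≟ρ = no λ ()

  sumToℕ : ℕ → (ℕ → ℕ) → ℕ
  sumToℕ zero    f = 0
  sumToℕ (suc m) f = sumToℕ m f + f (suc m)

  sumToℕ-cong : ∀ m {f g} → (∀ j → 1 ≤ j → j ≤ m → f j ≡ g j) → sumToℕ m f ≡ sumToℕ m g
  sumToℕ-cong zero    f≡g = refl
  sumToℕ-cong (suc m) f≡g =
    cong₂ _+_ (sumToℕ-cong m (λ j 1≤j j≤m → f≡g j 1≤j (ℕ.m≤n⇒m≤1+n j≤m))) (f≡g (suc m) (s≤s z≤n) ℕ.≤-refl)

  sumToℕ-zero : ∀ m → sumToℕ m (λ _ → 0) ≡ 0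
  sumToℕ-zero zero    = refl
  sumToℕ-zero (suc m) = trans (ℕ.+-identityʳ _) (sumToℕ-zero m)

  sumToℕ-bump : ∀ m {f g} i d → 1 ≤ i → i ≤ m → (∀ j → j ≢ i → g j ≡ f j) → g i ≡ d + f i →
                sumToℕ m g ≡ d + sumToℕ m f
  sumToℕ-bump zero    i d 1≤i i≤0 _ _ = ⊥-elim (ℕ.<⇒≱ 1≤i i≤0)
  sumToℕ-bump (suc m) {f} {g} i d 1≤i i≤m g≡f gi with ℕ.m≤n⇒m<n∨m≡n i≤m
  ... | inj₁ i<1+m = begin
    sumToℕ m g + g (suc m)   ≡⟨ cong₂ _+_ (sumToℕ-bump m i d 1≤i (ℕ.≤-pred i<1+m) g≡f gi)
                                          (g≡f (suc m) (λ { refl → ℕ.<-irrefl refl i<1+m })) ⟩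
    d + sumToℕ m f + f (suc m) ≡⟨ ℕ.+-assoc d _ _ ⟩
    d + (sumToℕ m f + f (suc m)) ∎
    where open ≡-Reasoning
  ... | inj₂ refl = begin
    sumToℕ m g + g (suc m)     ≡⟨ cong₂ _+_ (sumToℕ-cong m (λ j _ j≤m → g≡f j (λ { refl → ℕ.<-irrefl refl (s≤s j≤m) }))) gi ⟩
    sumToℕ m f + (d + f (suc m)) ≡⟨ x∙yz≈y∙xz (sumToℕ m f) d _ ⟩
    d + (sumToℕ m f + f (suc m)) ∎
    where open ≡-Reasoning

  sumToℕ-≥ : ∀ m f {i} → 1 ≤ i → i ≤ m → f i ≤ sumToℕ m f
  sumToℕ-≥ zero    f 1≤i i≤0 = ⊥-elim (ℕ.<⇒≱ 1≤i i≤0)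
  sumToℕ-≥ (suc m) f 1≤i i≤m with ℕ.m≤n⇒m<n∨m≡n i≤m
  ... | inj₁ i<1+m = ℕ.≤-trans (sumToℕ-≥ m f 1≤i (ℕ.≤-pred i<1+m)) (ℕ.m≤m+n _ _)
  ... | inj₂ refl  = ℕ.m≤n+m _ _

  if-suc : ∀ esc n → (if esc then suc n else n) ≡ (if esc then 1 else 0) + n
  if-suc true  n = refl
  if-suc false n = refl

  record Decomposition (b : Tree) (r : Config) (N E : ℕ) : Set where
    field
      returned          : ℕ
      sent escaped      : ℕ → ℕ
      N≡E+returned      : N ≡ E + returned
      E≡sum             : E ≡ sumToℕ (b []) escaped
      branch-run        : ∀ i → ∃[ c ] Run (branchTree b i) (branchConfig r i) (sent i) c (escaped i)
      returned≤1+sent   : ∀ i → 1 ≤ i → i ≤ b [] → returned ≤ suc (sent i)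

  t+[1+f]≤1+t+s+f : ∀ t s f → t + suc f ≤ suc t + s + f
  t+[1+f]≤1+t+s+f t s f = subst (_≤ suc t + s + f) (sym (ℕ.+-suc t f)) (s≤s (ℕ.+-monoˡ-≤ f (ℕ.m≤m+n t s)))

  module Bookkeeping (b : Tree) (r : Config) (b₀≥1 : 1 ≤ b []) where

    b₀ : ℕ
    b₀ = b []

    record BranchRun (D : Config) (i : ℕ) : Set where
      field
        sent escaped : ℕ
        rotors       : Config
        run          : Run (branchTree b i) (branchConfig r i) sent rotors escaped
        restricts    : rotors ≗ branchConfig D i

    open BranchRun

    BranchRun-transport : ∀ {D D' i} → branchConfig D' i ≗ branchConfig D i → BranchRun D i → BranchRun D' i
    BranchRun-transport D'≗D B = record
      { sent = sent B ; escaped = escaped B ; rotors = rotors B ; run = run B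
      ; restricts = λ a → trans (restricts B a) (sym (D'≗D a)) }

    -- Each full turn of the rotor at o sends one particle into every branch; the
    -- branches up to the current rotor position have already been served in this turn.
    Balanced : ℕ → ℕ → ℕ → ℕ → Set
    Balanced p returned i n = (i ≤ p → returned ≤ n) × returned ≤ suc n

    record Ledger (D : Config) (returned escapedTotal : ℕ) : Set where
      field
        branch        : ∀ i → BranchRun D i
        escaped-sum   : escapedTotal ≡ sumToℕ b₀ (λ i → escaped (branch i))
        rotor-o≤      : D [] ≤ b₀
        sent-balanced : ∀ i → 1 ≤ i → i ≤ b₀ → Balanced (D []) returned i (sent (branch i))

    open Ledger

    branchWalk : ∀ {D x E} → Ledger D x E → ℕ → ℕ → Config × Pos
    branchWalk L i = walk (branchTree b i) (rotors (branch L i))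

    firstReturn : ∀ {D x E} (L : Ledger D x E) i B → FirstHit (λ s → pos (branchWalk L i s) ≡ ρ) B
    firstReturn L i = firstHit (λ s → pos (branchWalk L i s) ≟ρ)

    Ledger-initial : IsConfig b r → Ledger r 0 0
    Ledger-initial r-ok = record
      { branch        = λ i → record { sent = 0 ; escaped = 0 ; rotors = branchConfig r i ; run = run0 ; restricts = λ _ → refl }
      ; escaped-sum   = sym (sumToℕ-zero b₀)
      ; rotor-o≤      = r-ok [] _
      ; sent-balanced = λ _ _ _ → (λ _ → z≤n) , z≤n
      }

    Ledger-return : ∀ {D D' x E} → Ledger D x E → advance b₀ (D []) ≡ 0 → D' [] ≡ 0 →
                    (∀ j → branchConfig D' j ≗ branchConfig D j) → Ledger D' (suc x) E
    Ledger-return {D} {D'} {x} L adv≡0 D'o≡0 same = record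
      { branch        = λ j → BranchRun-transport (same j) (branch L j)
      ; escaped-sum   = escaped-sum L
      ; rotor-o≤      = subst (_≤ b₀) (sym D'o≡0) z≤n
      ; sent-balanced = balanced
      }
      where
      rotor-was-last : D [] ≡ b₀
      rotor-was-last = advance≡0⇒≡ (rotor-o≤ L) adv≡0
      balanced : ∀ i → 1 ≤ i → i ≤ b₀ → Balanced (D' []) (suc x) i (sent (branch L i))
      balanced i 1≤i i≤b₀ rewrite D'o≡0 =
        (λ i≤0 → ⊥-elim (ℕ.<⇒≱ 1≤i i≤0)) ,
        s≤s (proj₁ (sent-balanced L i 1≤i i≤b₀) (subst (i ≤_) (sym rotor-was-last) i≤b₀))

    sendTo : ∀ {D D' x E} (L : Ledger D x E) i → (∀ k → k ≢ i → branchConfig D' k ≗ branchConfig D k) →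
             BranchRun D' i → ∀ k → BranchRun D' k
    sendTo L i same served k with k ℕ.≟ i
    ... | yes refl = served
    ... | no  k≢i  = BranchRun-transport (same k k≢i) (branch L k)

    sendTo-escaped : ∀ {D D' x E} (L : Ledger D x E) {i} same (served : BranchRun D' i) d → 1 ≤ i → i ≤ b₀ →
                     escaped served ≡ d + escaped (branch L i) →
                     sumToℕ b₀ (λ k → escaped (sendTo L i same served k)) ≡ d + E
    sendTo-escaped L {i} same served d 1≤i i≤b₀ served≡ =
      trans (sumToℕ-bump b₀ i d 1≤i i≤b₀ other self) (cong (d +_) (sym (escaped-sum L)))
      where
      other : ∀ k → k ≢ i → escaped (sendTo L i same served k) ≡ escaped (branch L k)
      other k k≢i with k ℕ.≟ i
      ... | yes k≡i = ⊥-elim (k≢i k≡i)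
      ... | no  _   = refl
      self : escaped (sendTo L i same served i) ≡ d + escaped (branch L i)
      self with i ℕ.≟ i
      ... | yes refl = served≡
      ... | no  i≢i  = ⊥-elim (i≢i refl)

    sendTo-balanced : ∀ {D D' x E j} (L : Ledger D x E) same (served : BranchRun D' (suc j)) →
                      D [] ≡ j → sent served ≡ suc (sent (branch L (suc j))) →
                      ∀ k → 1 ≤ k → k ≤ b₀ → Balanced (suc j) x k (sent (sendTo L (suc j) same served k))
    sendTo-balanced {j = j} L same served rotor-was sent≡ k 1≤k k≤b₀
      with k ℕ.≟ suc j | sent-balanced L k 1≤k k≤b₀
    ... | yes refl | _ , x≤1+n =
      subst (Balanced (suc j) _ (suc j)) (sym sent≡) ((λ _ → x≤1+n) , ℕ.m≤n⇒m≤1+n x≤1+n)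
    ... | no  k≢i  | served-if , x≤1+n =
      (λ k≤i → served-if (subst (k ≤_) (sym rotor-was) (ℕ.≤-pred (ℕ.≤∧≢⇒< k≤i k≢i)))) , x≤1+n

    Ledger-send : ∀ {D D' x E j c' esc} → (L : Ledger D x E) →
                  advance b₀ (D []) ≡ suc j → D' [] ≡ suc j →
                  (∀ k → k ≢ suc j → branchConfig D' k ≗ branchConfig D k) →
                  Particle (branchTree b (suc j)) (rotors (branch L (suc j))) c' esc →
                  c' ≗ branchConfig D' (suc j) →
                  Ledger D' x (if esc then suc E else E)
    Ledger-send {D} {D'} {x} {E} {j} {c'} {esc} L adv≡i D'o≡i same particle c'≗D' = record
      { branch        = sendTo L (suc j) same served
      ; escaped-sum   = trans (if-suc esc E) (sym (sendTo-escaped L same served _ (s≤s z≤n) i≤b₀ (if-suc esc _)))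
      ; rotor-o≤      = subst (_≤ b₀) (sym D'o≡i) i≤b₀
      ; sent-balanced = λ k 1≤k k≤b₀ → subst (λ p → Balanced p x k (sent (sendTo L (suc j) same served k))) (sym D'o≡i)
                          (sendTo-balanced L same served (advance≡suc⇒≡ (rotor-o≤ L) adv≡i) refl k 1≤k k≤b₀)
      }
      where
      Bᵢ : BranchRun D (suc j)
      Bᵢ = branch L (suc j)
      served : BranchRun D' (suc j)
      served = record
        { sent = suc (sent Bᵢ) ; escaped = if esc then suc (escaped Bᵢ) else escaped Bᵢ
        ; rotors = c' ; run = runS (run Bᵢ) particle ; restricts = c'≗D' }
      i≤b₀ : suc j ≤ b₀
      i≤b₀ = subst (_≤ b₀) adv≡i (advance≤ b₀ (D []))

    step-o-rotor : ∀ s → pos s ≡ at [] → cfg (step b s) [] ≡ advance b₀ (cfg s [])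
    step-o-rotor (D , .(at [])) refl = update-≡ D [] _

    step-o-branches : ∀ s → pos s ≡ at [] → ∀ j → branchConfig (cfg (step b s)) j ≗ branchConfig (cfg s) j
    step-o-branches (D , .(at [])) refl j a = update-≢ D [] _ (≢-sym ([]≢∷ʳ a j))

    step-o-pos : ∀ s → pos s ≡ at [] → pos (step b s) ≡ nbr [] (advance b₀ (cfg s []))
    step-o-pos (D , .(at [])) refl = refl

    module Walk (C : Config) where

      W : ℕ → Config × Pos
      W = walk b C

      AtBase : ℕ → Set
      AtBase t = pos (W t) ≡ at []

      enter-branch : ∀ t {j c} → AtBase t → advance b₀ (cfg (W t) []) ≡ suc j →
                     c ≗ branchConfig (cfg (W t)) (suc j) → ∀ s →
                     (∀ s' → 1 ≤ s' → s' ≤ s → pos (walk (branchTree b (suc j)) c s') ≢ ρ) →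
                     Simulates (suc j) (W (suc t + s)) (walk (branchTree b (suc j)) c (suc s)) ×
                     UnchangedOutside (suc j) (cfg (W (suc t))) (cfg (W (suc t + s)))
      enter-branch t {j} {c} at-o adv≡i c≗D s no-return =
        subst₂ (Simulates i) (sym (walk-+ b C (suc t) s)) (sym (walk-+ bᵢ c 1 s)) (proj₁ simulation) ,
        λ x x∉ → trans (cong (λ z → cfg z x) (walk-+ b C (suc t) s)) (proj₂ simulation x x∉)
        where
        i : ℕ
        i = suc j
        bᵢ : Tree
        bᵢ = branchTree b i
        entered : Simulates i (W (suc t)) (walk bᵢ c 1)
        entered = (λ a → trans (c≗D a) (sym (step-o-branches (W t) at-o i a))) ,
                  subst (λ p → BranchPos i p (at [])) (sym (trans (step-o-pos (W t) at-o) (cong (nbr []) adv≡i))) (inside [])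
        simulation : Simulates i (steps b (W (suc t)) s) (steps bᵢ (walk bᵢ c 1) s) ×
                     UnchangedOutside i (cfg (W (suc t))) (cfg (steps b (W (suc t)) s))
        simulation = steps-simulate b i s entered
          (λ s' s'<s → subst (λ z → pos z ≢ ρ) (walk-+ bᵢ c 1 s') (no-return (suc s') (s≤s z≤n) s'<s))

      after-excursion : ∀ t {j D'} → AtBase t → advance b₀ (cfg (W t) []) ≡ suc j →
                        UnchangedOutside (suc j) (cfg (W (suc t))) D' →
                        D' [] ≡ suc j × (∀ k → k ≢ suc j → branchConfig D' k ≗ branchConfig (cfg (W t)) k)
      after-excursion t {j} at-o adv≡i unchanged =
        trans (unchanged [] (λ a → []≢∷ʳ a (suc j))) (trans (step-o-rotor (W t) at-o) adv≡i) ,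
        λ k k≢i a → trans (unchanged (a ∷ʳ k) (λ a' e → k≢i (proj₂ (∷ʳ-injective a a' e))))
                          (step-o-branches (W t) at-o k a)

      excursion-returns : ∀ t {x E j s} → AtBase t → advance b₀ (cfg (W t) []) ≡ suc j →
                          (L : Ledger (cfg (W t)) x E) →
                          pos (branchWalk L (suc j) (suc s)) ≡ ρ →
                          (∀ s' → 0 < s' → s' < suc s → pos (branchWalk L (suc j) s') ≢ ρ) →
                          AtBase (suc t + s) × Ledger (cfg (W (suc t + s))) x E
      excursion-returns t {j = j} {s} at-o adv≡i L returned first =
        BranchPos-ρ (subst (BranchPos (suc j) _) returned (proj₂ (proj₁ sim))) ,
        Ledger-send L adv≡i (proj₁ after) (proj₂ after) (returns (suc s) (s≤s z≤n) returned first) (proj₁ (proj₁ sim))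
        where
        sim : Simulates (suc j) (W (suc t + s)) (branchWalk L (suc j) (suc s)) ×
              UnchangedOutside (suc j) (cfg (W (suc t))) (cfg (W (suc t + s)))
        sim = enter-branch t at-o adv≡i (restricts (branch L (suc j))) s (λ s' 0<s' s'≤s → first s' 0<s' (s≤s s'≤s))
        after : cfg (W (suc t + s)) [] ≡ suc j ×
                (∀ k → k ≢ suc j → branchConfig (cfg (W (suc t + s))) k ≗ branchConfig (cfg (W t)) k)
        after = after-excursion t at-o adv≡i (proj₂ sim)

      excursion-escapes : ∀ t {x E j r'} → AtBase t → advance b₀ (cfg (W t) []) ≡ suc j →
                          (L : Ledger (cfg (W t)) x E) →
                          (∀ s → 0 < s → pos (branchWalk L (suc j) s) ≢ ρ) →
                          (∀ a → ∃[ K ] ∀ k → K ≤ k → cfg (W k) a ≡ r' a) →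
                          Ledger r' x (suc E)
      excursion-escapes t {j = j} {r'} at-o adv≡i L never stabilizes =
        Ledger-send L adv≡i (proj₁ after) (proj₂ after) (escapes (branchConfig r' i) never stabilizes-in-branch) (λ _ → refl)
        where
        i : ℕ
        i = suc j
        sim : ∀ s → Simulates i (W (suc t + s)) (branchWalk L i (suc s)) ×
                    UnchangedOutside i (cfg (W (suc t))) (cfg (W (suc t + s)))
        sim s = enter-branch t at-o adv≡i (restricts (branch L i)) s (λ s' 0<s' _ → never s' 0<s')
        limit : ∀ a → r' a ≡ cfg (W (suc t + proj₁ (stabilizes a))) a
        limit a = sym (proj₂ (stabilizes a) _ (ℕ.m≤n+m _ (suc t)))
        after : r' [] ≡ i × (∀ k → k ≢ i → branchConfig r' k ≗ branchConfig (cfg (W t)) k)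
        after = after-excursion t at-o adv≡i (λ a a∉ → trans (limit a) (proj₂ (sim _) a a∉))
        stabilizes-in-branch : ∀ a → ∃[ K ] ∀ k → K ≤ k → cfg (branchWalk L i k) a ≡ branchConfig r' i a
        stabilizes-in-branch a = suc (proj₁ (stabilizes (a ∷ʳ i))) , λ { (suc k) (s≤s K≤k) →
          trans (proj₁ (proj₁ (sim k)) a) (proj₂ (stabilizes (a ∷ʳ i)) _ (ℕ.≤-trans K≤k (ℕ.m≤n+m k (suc t)))) }

      module Returning (k : ℕ) (at-ρ : pos (W k) ≡ ρ) (first : ∀ j → 0 < j → j < k → pos (W j) ≢ ρ) where

        -- The fuel f (with k ≤ t + f) drops at each visit to o, as the visits happen at distinct times t < k.
        loop : ∀ f t {x E} → k ≤ t + f → t < k → AtBase t → Ledger (cfg (W t)) x E → Ledger (cfg (W k)) (suc x) E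
        loop zero    t k≤t+0 t<k _ _ = ⊥-elim (ℕ.<⇒≱ t<k (subst (k ≤_) (ℕ.+-identityʳ t) k≤t+0))
        loop (suc f) t {x} {E} k≤t+f t<k at-o L = depart _ refl
          where
          depart : ∀ a → advance b₀ (cfg (W t) []) ≡ a → Ledger (cfg (W k)) (suc x) E
          depart zero adv≡0 =
            subst (λ u → Ledger (cfg (W u)) (suc x) E) 1+t≡k
              (Ledger-return L adv≡0 (trans (step-o-rotor (W t) at-o) adv≡0) (step-o-branches (W t) at-o))
            where
            1+t≡k : suc t ≡ k
            1+t≡k with ℕ.m≤n⇒m<n∨m≡n t<k
            ... | inj₂ 1+t≡k = 1+t≡k
            ... | inj₁ 1+t<k = ⊥-elim (first (suc t) (s≤s z≤n) 1+t<k (trans (step-o-pos (W t) at-o) (cong (nbr []) adv≡0)))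
          depart (suc j) adv≡i with firstReturn L (suc j) (k ∸ t)
          ... | hit (suc s) (s≤s z≤n) 1+s≤k∸t returned first' =
            loop f (suc t + s) (ℕ.≤-trans k≤t+f (t+[1+f]≤1+t+s+f t s f)) (ℕ.≤∧≢⇒< back≤k back≢k) (proj₁ back) (proj₂ back)
            where
            back : AtBase (suc t + s) × Ledger (cfg (W (suc t + s))) x E
            back = excursion-returns t at-o adv≡i L returned first'
            back≤k : suc t + s ≤ k
            back≤k = subst (suc t + s ≤_) (ℕ.m+[n∸m]≡n (ℕ.<⇒≤ t<k)) (subst (_≤ t + (k ∸ t)) (ℕ.+-suc t s) (ℕ.+-monoʳ-≤ t 1+s≤k∸t))
            back≢k : suc t + s ≢ k
            back≢k back≡k = at≢ρ (trans (sym (proj₁ back)) (subst (λ u → pos (W u) ≡ ρ) (sym back≡k) at-ρ))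
          ... | noHit none = ⊥-elim (BranchPos-≢ρ (proj₂ (proj₁ sim)) (subst (λ u → pos (W u) ≡ ρ) (sym (ℕ.m+[n∸m]≡n t<k)) at-ρ))
            where
            sim : Simulates (suc j) (W (suc t + (k ∸ suc t))) (branchWalk L (suc j) (suc (k ∸ suc t))) ×
                  UnchangedOutside (suc j) (cfg (W (suc t))) (cfg (W (suc t + (k ∸ suc t))))
            sim = enter-branch t at-o adv≡i (restricts (branch L (suc j))) (k ∸ suc t)
                    (λ s' 0<s' s'≤ → none s' 0<s' (ℕ.≤-trans s'≤ (ℕ.∸-monoʳ-≤ k (ℕ.n≤1+n t))))

      module Escaping (r' : Config) (never : ∀ k → 0 < k → pos (W k) ≢ ρ)
                      (stabilizes : ∀ a → ∃[ K ] ∀ k → K ≤ k → cfg (W k) a ≡ r' a) where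

        K₀ : ℕ
        K₀ = proj₁ (stabilizes [])

        -- Every visit to o turns the rotor at o, which stops turning at time K₀.
        no-visit-after : ∀ u → K₀ ≤ u → ¬ AtBase u
        no-visit-after u K₀≤u at-o = advance≢ (cfg (W u) []) b₀≥1 (begin
          advance b₀ (cfg (W u) []) ≡⟨ step-o-rotor (W u) at-o ⟨
          cfg (W (suc u)) []        ≡⟨ proj₂ (stabilizes []) (suc u) (ℕ.m≤n⇒m≤1+n K₀≤u) ⟩
          r' []                     ≡⟨ proj₂ (stabilizes []) u K₀≤u ⟨
          cfg (W u) []              ∎)
          where open ≡-Reasoning

        loop : ∀ f t {x E} → K₀ ≤ t + f → AtBase t → Ledger (cfg (W t)) x E → Ledger r' x (suc E)
        loop zero    t K₀≤t+0 at-o _ = ⊥-elim (no-visit-after t (subst (K₀ ≤_) (ℕ.+-identityʳ t) K₀≤t+0) at-o)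
        loop (suc f) t {x} {E} K₀≤t+f at-o L = depart _ refl
          where
          depart : ∀ a → advance b₀ (cfg (W t) []) ≡ a → Ledger r' x (suc E)
          depart zero adv≡0 = ⊥-elim (never (suc t) (s≤s z≤n) (trans (step-o-pos (W t) at-o) (cong (nbr []) adv≡0)))
          depart (suc j) adv≡i with firstReturn L (suc j) (K₀ ∸ t)
          ... | hit (suc s) (s≤s z≤n) _ returned first' =
            loop f (suc t + s) (ℕ.≤-trans K₀≤t+f (t+[1+f]≤1+t+s+f t s f)) (proj₁ back) (proj₂ back)
            where
            back : AtBase (suc t + s) × Ledger (cfg (W (suc t + s))) x E
            back = excursion-returns t at-o adv≡i L returned first'
          ... | noHit none = excursion-escapes t at-o adv≡i L never-returns stabilizes
            where
            -- A return after the search bound K₀ ∸ t would be a visit to o after time K₀.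
            never-returns : ∀ s → 0 < s → pos (branchWalk L (suc j) s) ≢ ρ
            never-returns s 0<s returned with firstReturn L (suc j) s
            ... | noHit none' = none' s 0<s ℕ.≤-refl returned
            ... | hit (suc s₀) (s≤s z≤n) _ returned₀ first₀ with suc s₀ ℕ.≤? K₀ ∸ t
            ...   | yes 1+s₀≤K₀∸t = none (suc s₀) (s≤s z≤n) 1+s₀≤K₀∸t returned₀
            ...   | no  1+s₀≰K₀∸t = no-visit-after (suc t + s₀) K₀≤1+t+s₀ (proj₁ (excursion-returns t at-o adv≡i L returned₀ first₀))
              where
              K₀≤1+t+s₀ : K₀ ≤ suc t + s₀
              K₀≤1+t+s₀ = ℕ.≤-trans (ℕ.m≤n+m∸n K₀ t)
                            (ℕ.≤-trans (ℕ.+-monoʳ-≤ t (ℕ.≤-pred (ℕ.≰⇒> 1+s₀≰K₀∸t))) (ℕ.n≤1+n (t + s₀)))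

    ledger-after-particle : ∀ {C C' esc x E} → Ledger C x E → Particle b C C' esc →
                            Ledger C' (if esc then x else suc x) (if esc then suc E else E)
    ledger-after-particle {C} L (returns k 0<k at-ρ first) =
      Walk.Returning.loop C k at-ρ first k 1 (ℕ.n≤1+n k) (1<k k 0<k at-ρ) refl L
      where
      1<k : ∀ k → 0 < k → pos (walk b C k) ≡ ρ → 1 < k
      1<k (suc zero)    _ ()
      1<k (suc (suc k)) _ _ = s≤s (s≤s z≤n)
    ledger-after-particle {C} L (escapes r' never stabilizes) =
      Walk.Escaping.loop C r' never stabilizes _ 1 (ℕ.n≤1+n _) refl L

    ledger-after-run : IsConfig b r → ∀ {N C E} → Run b r N C E → ∃[ x ] (N ≡ E + x × Ledger C x E)
    ledger-after-run r-ok run0 = 0 , refl , Ledger-initial r-ok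
    ledger-after-run r-ok (runS R particle@(returns _ _ _ _)) with ledger-after-run r-ok R
    ... | x , N≡E+x , L = suc x , trans (cong suc N≡E+x) (sym (ℕ.+-suc _ x)) , ledger-after-particle L particle
    ledger-after-run r-ok (runS R particle@(escapes _ _ _)) with ledger-after-run r-ok R
    ... | x , N≡E+x , L = x , cong suc N≡E+x , ledger-after-particle L particle

    run-decomposes : IsConfig b r → ∀ {N C E} → Run b r N C E → Decomposition b r N E
    run-decomposes r-ok R with ledger-after-run r-ok R
    ... | x , N≡E+x , L = record
      { returned        = x
      ; sent            = λ i → sent (branch L i)
      ; escaped         = λ i → escaped (branch L i)
      ; N≡E+returned    = N≡E+x
      ; E≡sum           = escaped-sum L
      ; branch-run      = λ i → rotors (branch L i) , run (branch L i)
      ; returned≤1+sent = λ i 1≤i i≤b₀ → proj₂ (sent-balanced L i 1≤i i≤b₀)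
      }

module Rates where

  open import Data.Integer as ℤ using (+_; -[1+_])
  import Data.Integer.Properties as ℤ
  open import Data.Rational using (_+_)
  open RotorWalk

  fromℕ : ℕ → ℚ
  fromℕ n = mkℚ (+ n) 0 (Coprimality.sym (Coprimality.1-coprimeTo n))

  fromℕ-/1 : ∀ n → + n / 1 ≡ fromℕ n
  fromℕ-/1 n = ℚ.↥p/↧p≡p (fromℕ n)

  fromℕ-+ : ∀ m n → fromℕ (m ℕ.+ n) ≡ fromℕ m + fromℕ n
  fromℕ-+ m n = sym (trans (ℚ./-cong {p₂ = + (m ℕ.+ n)} num refl) (fromℕ-/1 (m ℕ.+ n)))
    where
    num : + m ℤ.* + 1 ℤ.+ + n ℤ.* + 1 ≡ + (m ℕ.+ n)
    num = trans (cong₂ ℤ._+_ (ℤ.*-identityʳ (+ m)) (ℤ.*-identityʳ (+ n))) (sym (ℤ.pos-+ m n))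

  fromℕ-mono-≤ : ∀ {m n} → m ℕ.≤ n → fromℕ m ℚ.≤ fromℕ n
  fromℕ-mono-≤ {m} {n} m≤n = *≤* (subst₂ ℤ._≤_ (sym (ℤ.*-identityʳ (+ m))) (sym (ℤ.*-identityʳ (+ n))) (ℤ.+≤+ m≤n))

  fromℕ-nonNeg : ∀ n → 0ℚ ℚ.≤ fromℕ n
  fromℕ-nonNeg n = fromℕ-mono-≤ z≤n

  /-*-cancel : ∀ e m → (+ e / suc m) * fromℕ (suc m) ≡ fromℕ e
  /-*-cancel e m = cancel (+ e / suc m) (ℚ.toℚᵘ-fromℚᵘ (ℚᵘ.mkℚᵘ (+ e) m))
    where
    cancel : ∀ p → toℚᵘ p ℚᵘ.≃ ℚᵘ.mkℚᵘ (+ e) m → p * fromℕ (suc m) ≡ fromℕ e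
    cancel p@(mkℚ n d _) (ℚᵘ.*≡* cross) = trans (ℚ.fromℚᵘ-cong {ℚᵘ.mkℚᵘ (n ℤ.* + suc m) (d ℕ.* 1)} {ℚᵘ.mkℚᵘ (+ e) 0} (ℚᵘ.*≡* cross′)) (fromℕ-/1 e)
      where
      cross′ : (n ℤ.* + suc m) ℤ.* + 1 ≡ + e ℤ.* + (↧ₙ p ℕ.* 1)
      cross′ = trans (ℤ.*-identityʳ _) (trans cross (cong (λ z → + e ℤ.* + z) (sym (ℕ.*-identityʳ (↧ₙ p)))))

  archimedean : ∀ p → ∃[ K ] p ℚ.≤ fromℕ K
  archimedean (mkℚ (+ a) d _) =
    a , *≤* (subst₂ ℤ._≤_ (ℤ.pos-* a 1) (ℤ.pos-* a (suc d)) (ℤ.+≤+ (ℕ.*-monoʳ-≤ a (s≤s z≤n))))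
  archimedean (mkℚ -[1+ a ] d _) = 0 , *≤* ℤ.-≤+

  sumTo-mono-≤ : ∀ m {f g} → (∀ i → 1 ℕ.≤ i → i ℕ.≤ m → f i ℚ.≤ g i) → sumTo m f ℚ.≤ sumTo m g
  sumTo-mono-≤ zero    f≤g = ℚ.≤-refl
  sumTo-mono-≤ (suc m) f≤g =
    ℚ.+-mono-≤ (sumTo-mono-≤ m (λ i 1≤i i≤m → f≤g i 1≤i (ℕ.m≤n⇒m≤1+n i≤m))) (f≤g (suc m) (s≤s z≤n) ℕ.≤-refl)

  sumTo-+ : ∀ m f g → sumTo m (λ i → f i + g i) ≡ sumTo m f + sumTo m g
  sumTo-+ zero    f g = refl
  sumTo-+ (suc m) f g rewrite sumTo-+ m f g =
    solve 4 (λ F G a b → (F :+ G) :+ (a :+ b) := (F :+ a) :+ (G :+ b)) refl (sumTo m f) (sumTo m g) (f (suc m)) (g (suc m))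

  sumTo-*ʳ : ∀ m f c → sumTo m (λ i → f i * c) ≡ sumTo m f * c
  sumTo-*ʳ zero    f c = sym (ℚ.*-zeroˡ c)
  sumTo-*ʳ (suc m) f c rewrite sumTo-*ʳ m f c = sym (ℚ.*-distribʳ-+ c (sumTo m f) (f (suc m)))

  sumTo-minus-const : ∀ m f c → sumTo m (λ i → f i - c) ≡ sumTo m f - fromℕ m * c
  sumTo-minus-const zero    f c = solve 1 (λ c → con 0ℚ := con 0ℚ :- con 0ℚ :* c) refl c
  sumTo-minus-const (suc m) f c rewrite sumTo-minus-const m f c | fromℕ-+ 1 m =
    solve 4 (λ F a m c → (F :- m :* c) :+ (a :- c) := (F :+ a) :- (con 1ℚ :+ m) :* c) refl (sumTo m f) (f (suc m)) (fromℕ m) c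

  sumTo-fromℕ : ∀ m f → sumTo m (λ i → fromℕ (f i)) ≡ fromℕ (sumToℕ m f)
  sumTo-fromℕ zero    f = refl
  sumTo-fromℕ (suc m) f rewrite sumTo-fromℕ m f = sym (fromℕ-+ (sumToℕ m f) (f (suc m)))

  open ℚ.≤-Reasoning

  *-monoʳ-≤-≥0 : ∀ {p q} r → 0ℚ ℚ.≤ r → p ℚ.≤ q → p * r ℚ.≤ q * r
  *-monoʳ-≤-≥0 r 0≤r = ℚ.*-monoʳ-≤-nonNeg r {{ℚ.nonNegative 0≤r}}

  *-monoˡ-≤-≥0 : ∀ {p q} r → 0ℚ ℚ.≤ r → p ℚ.≤ q → r * p ℚ.≤ r * q
  *-monoˡ-≤-≥0 r 0≤r = ℚ.*-monoˡ-≤-nonNeg r {{ℚ.nonNegative 0≤r}}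

  *-≥0 : ∀ {p q} → 0ℚ ℚ.≤ p → 0ℚ ℚ.≤ q → 0ℚ ℚ.≤ p * q
  *-≥0 {p} {q} 0≤p 0≤q = subst (ℚ._≤ p * q) (ℚ.*-zeroˡ q) (*-monoʳ-≤-≥0 q 0≤q 0≤p)

  p≤p+q : ∀ p {q} → 0ℚ ℚ.≤ q → p ℚ.≤ p + q
  p≤p+q p {q} 0≤q = subst (ℚ._≤ p + q) (ℚ.+-identityʳ p) (ℚ.+-monoʳ-≤ p 0≤q)

  p-q≤p : ∀ p {q} → 0ℚ ℚ.≤ q → p - q ℚ.≤ p
  p-q≤p p 0≤q = subst (p - _ ℚ.≤_) (ℚ.+-identityʳ p) (ℚ.+-monoʳ-≤ p (ℚ.neg-antimono-≤ 0≤q))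

  -- The term q·M covers branches that have received at most M₀ ≤ M particles.
  escapes-lower-bound : ∀ {q δ : ℚ} {y n e M₀ M : ℕ} → M₀ ℕ.≤ M → 0ℚ ℚ.≤ q → 0ℚ ℚ.≤ δ → y ℕ.≤ n →
                        (M₀ ℕ.< n → (q - δ) * fromℕ n ℚ.≤ fromℕ e) →
                        (q - δ) * fromℕ y ℚ.≤ fromℕ e + q * fromℕ M
  escapes-lower-bound {q} {δ} {y} {n} {e} {M₀} {M} M₀≤M 0≤q 0≤δ y≤n above with q ℚ.≤? δ | M₀ ℕ.<? n
  ... | yes q≤δ | _ = begin
    (q - δ) * fromℕ y ≤⟨ *-monoʳ-≤-≥0 (fromℕ y) (fromℕ-nonNeg y) q-δ≤0 ⟩
    0ℚ * fromℕ y      ≡⟨ ℚ.*-zeroˡ (fromℕ y) ⟩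
    0ℚ                ≤⟨ ℚ.+-mono-≤ (fromℕ-nonNeg e) (*-≥0 0≤q (fromℕ-nonNeg M)) ⟩
    fromℕ e + q * fromℕ M ∎
    where
    q-δ≤0 : q - δ ℚ.≤ 0ℚ
    q-δ≤0 = subst (q - δ ℚ.≤_) (ℚ.+-inverseʳ δ) (ℚ.+-monoˡ-≤ (- δ) q≤δ)
  ... | no q≰δ | yes M₀<n = begin
    (q - δ) * fromℕ y ≤⟨ *-monoˡ-≤-≥0 (q - δ) 0≤q-δ (fromℕ-mono-≤ y≤n) ⟩
    (q - δ) * fromℕ n ≤⟨ above M₀<n ⟩
    fromℕ e           ≤⟨ p≤p+q (fromℕ e) (*-≥0 0≤q (fromℕ-nonNeg M)) ⟩
    fromℕ e + q * fromℕ M ∎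
    where
    0≤q-δ : 0ℚ ℚ.≤ q - δ
    0≤q-δ = subst (ℚ._≤ q - δ) (ℚ.+-inverseʳ δ) (ℚ.+-monoˡ-≤ (- δ) (ℚ.<⇒≤ (ℚ.≰⇒> q≰δ)))
  ... | no _ | no M₀≮n = begin
    (q - δ) * fromℕ y ≤⟨ *-monoʳ-≤-≥0 (fromℕ y) (fromℕ-nonNeg y) (p-q≤p q 0≤δ) ⟩
    q * fromℕ y       ≤⟨ *-monoˡ-≤-≥0 q 0≤q (fromℕ-mono-≤ (ℕ.≤-trans y≤n (ℕ.≤-trans (ℕ.≮⇒≥ M₀≮n) M₀≤M))) ⟩
    q * fromℕ M       ≤⟨ ℚ.≤-reflexive (sym (ℚ.+-identityˡ _)) ⟩
    0ℚ + q * fromℕ M  ≤⟨ ℚ.+-monoˡ-≤ (q * fromℕ M) (fromℕ-nonNeg e) ⟩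
    fromℕ e + q * fromℕ M ∎

  returned-bound : ∀ {S h e x y M N : ℚ} → 0ℚ ℚ.≤ S → 0ℚ ℚ.≤ h → x ℚ.≤ 1ℚ + y → y ℚ.≤ N →
                   (S - h) * y ℚ.≤ e + S * M → S * (1ℚ + M) ℚ.≤ h * N → S * x ℚ.≤ e + (h + h) * N
  returned-bound {S} {h} {e} {x} {y} {M} {N} 0≤S 0≤h x≤1+y y≤N branches M-small = begin
    S * x                                ≤⟨ *-monoˡ-≤-≥0 S 0≤S x≤1+y ⟩
    S * (1ℚ + y)                         ≡⟨ solve 3 (λ S h y → S :* (con 1ℚ :+ y) := S :+ ((S :- h) :* y :+ h :* y)) refl S h y ⟩
    S + ((S - h) * y + h * y)            ≤⟨ ℚ.+-monoʳ-≤ S (ℚ.+-monoˡ-≤ (h * y) branches) ⟩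
    S + ((e + S * M) + h * y)            ≡⟨ solve 5 (λ S e M h y → S :+ ((e :+ S :* M) :+ h :* y) := e :+ S :* (con 1ℚ :+ M) :+ h :* y) refl S e M h y ⟩
    e + S * (1ℚ + M) + h * y             ≤⟨ ℚ.+-mono-≤ (ℚ.+-monoʳ-≤ e M-small) (*-monoˡ-≤-≥0 h 0≤h y≤N) ⟩
    e + h * N + h * N                    ≡⟨ solve 3 (λ e h N → e :+ h :* N :+ h :* N := e :+ (h :+ h) :* N) refl e h N ⟩
    e + (h + h) * N                      ∎

  escape-fraction : ∀ {S u ε e x : ℚ} → u * (1ℚ + S) ≡ 1ℚ → 0ℚ ℚ.≤ u → u ℚ.≤ 1ℚ → 0ℚ ℚ.≤ ε * (e + x) →
                    S * x ℚ.≤ e + ε * (e + x) → (1ℚ - u - ε) * (e + x) ℚ.≤ e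
  escape-fraction {S} {u} {ε} {e} {x} u[1+S]≡1 0≤u u≤1 0≤Z returned = begin
    (1ℚ - u - ε) * (e + x)               ≡⟨ cong (λ one → (one - u - ε) * (e + x)) (sym u[1+S]≡1) ⟩
    (u * (1ℚ + S) - u - ε) * (e + x)     ≡⟨ solve 5 (λ u S ε e x → (u :* (con 1ℚ :+ S) :- u :- ε) :* (e :+ x) := u :* S :* e :+ u :* (S :* x) :- ε :* (e :+ x)) refl u S ε e x ⟩
    u * S * e + u * (S * x) - Z          ≤⟨ ℚ.+-monoˡ-≤ (- Z) (ℚ.+-monoʳ-≤ (u * S * e) (*-monoˡ-≤-≥0 u 0≤u returned)) ⟩
    u * S * e + u * (e + Z) - Z          ≡⟨ solve 4 (λ u S e Z → u :* S :* e :+ u :* (e :+ Z) :- Z := u :* (con 1ℚ :+ S) :* e :+ u :* Z :- Z) refl u S e Z ⟩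
    u * (1ℚ + S) * e + u * Z - Z         ≤⟨ ℚ.+-monoˡ-≤ (- Z) (ℚ.+-monoʳ-≤ (u * (1ℚ + S) * e) (*-monoʳ-≤-≥0 Z 0≤Z u≤1)) ⟩
    u * (1ℚ + S) * e + 1ℚ * Z - Z        ≡⟨ cong (λ v → v * e + 1ℚ * Z - Z) u[1+S]≡1 ⟩
    1ℚ * e + 1ℚ * Z - Z                  ≡⟨ solve 2 (λ e Z → con 1ℚ :* e :+ con 1ℚ :* Z :- Z := e) refl e Z ⟩
    e                                    ∎
    where
    Z : ℚ
    Z = ε * (e + x)

  infinite⇒1≤b₀ : ∀ b → Infinite b → 1 ≤ b []
  infinite⇒1≤b₀ b inf with inf 1
  ... | (_ ∷ []) , (_ , 1≤k , k≤b₀) , _ = ℕ.≤-trans 1≤k k≤b₀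

  bound-reciprocal : ∀ S (0≤S : 0ℚ ℚ.≤ S) →
                     ∃[ u ] (bound S 0≤S ≡ 1ℚ - u × u * (1ℚ + S) ≡ 1ℚ × 0ℚ ℚ.≤ u × u ℚ.≤ 1ℚ)
  bound-reciprocal S 0≤S = u , refl , u[1+S]≡1 , 0≤u , u≤1
    where
    instance
      1+S>0 : ℚ.Positive (1ℚ + S)
      1+S>0 = ℚ.pos+nonNeg⇒pos 1ℚ S {{ℚ.nonNegative 0≤S}}
      1+S≢0 : ℚ.NonZero (1ℚ + S)
      1+S≢0 = ℚ.pos⇒nonZero (1ℚ + S)
    u : ℚ
    u = 1/ (1ℚ + S)
    u[1+S]≡1 : u * (1ℚ + S) ≡ 1ℚ
    u[1+S]≡1 = ℚ.*-inverseˡ (1ℚ + S)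
    0≤u : 0ℚ ℚ.≤ u
    0≤u = ℚ.<⇒≤ (ℚ.positive⁻¹ u {{ℚ.1/pos⇒pos (1ℚ + S)}})
    u≤1 : u ℚ.≤ 1ℚ
    u≤1 = subst₂ ℚ._≤_ (ℚ.*-identityʳ u) u[1+S]≡1 (*-monoˡ-≤-≥0 u 0≤u (p≤p+q 1ℚ 0≤S))

  divide-evenly : ∀ {m} h → 1 ≤ m → 0ℚ ℚ.< h → ∃[ δ ] (0ℚ ℚ.< δ × fromℕ m * δ ≡ h)
  divide-evenly {suc m} h _ 0<h = h * 1/ fromℕ (suc m) , 0<δ , m·δ≡h
    where
    instance
      h>0 : ℚ.Positive h
      h>0 = ℚ.positive 0<h
    0<δ : 0ℚ ℚ.< h * 1/ fromℕ (suc m)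
    0<δ = ℚ.positive⁻¹ _ {{ℚ.pos*pos⇒pos h _ {{ℚ.1/pos⇒pos (fromℕ (suc m))}}}}
    m·δ≡h : fromℕ (suc m) * (h * 1/ fromℕ (suc m)) ≡ h
    m·δ≡h = trans (solve 3 (λ m h m⁻¹ → m :* (h :* m⁻¹) := h :* (m :* m⁻¹)) refl (fromℕ (suc m)) h (1/ fromℕ (suc m)))
                  (trans (cong (h *_) (ℚ.*-inverseʳ (fromℕ (suc m)))) (ℚ.*-identityʳ h))

  eventually-below : ∀ A {h} → 0ℚ ℚ.< h → ∃[ K ] ∀ n → K ≤ n → A ℚ.≤ h * fromℕ n
  eventually-below A {h} 0<h = proj₁ K , λ n K≤n →
    subst (ℚ._≤ h * fromℕ n) h·A/h≡A (*-monoˡ-≤-≥0 h (ℚ.<⇒≤ 0<h) (ℚ.≤-trans (proj₂ K) (fromℕ-mono-≤ K≤n)))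
    where
    instance
      h≢0 : ℚ.NonZero h
      h≢0 = ℚ.pos⇒nonZero h {{ℚ.positive 0<h}}
    K : ∃[ K ] A * 1/ h ℚ.≤ fromℕ K
    K = archimedean (A * 1/ h)
    h·A/h≡A : h * (A * 1/ h) ≡ A
    h·A/h≡A = trans (solve 3 (λ h A h⁻¹ → h :* (A :* h⁻¹) := A :* (h :* h⁻¹)) refl h A (1/ h))
                    (trans (cong (A *_) (ℚ.*-inverseʳ h)) (ℚ.*-identityʳ A))

  Thresholds : Tree → Config → (ℕ → ℚ) → ℚ → (ℕ → ℕ) → Set
  Thresholds b r q δ M₀ = ∀ i → 1 ≤ i → i ≤ b [] → ∀ n C e → M₀ i < n →
                          Run (branchTree b i) (branchConfig r i) n C e → (q i - δ) * fromℕ n ℚ.≤ fromℕ e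

  liminf-threshold : ∀ {b r q δ} → LiminfAtLeast b r q → 0ℚ ℚ.< δ →
                     ∃[ M₀ ] ∀ n C e → M₀ < n → Run b r n C e → (q - δ) * fromℕ n ℚ.≤ fromℕ e
  liminf-threshold {b} {r} {q} {δ} liminf 0<δ with liminf δ 0<δ
  ... | M₀ , eventually = M₀ , bound-at
    where
    bound-at : ∀ n C e → M₀ < n → Run b r n C e → (q - δ) * fromℕ n ℚ.≤ fromℕ e
    bound-at (suc m) C e (s≤s M₀≤m) R =
      subst ((q - δ) * fromℕ (suc m) ℚ.≤_) (/-*-cancel e m)
        (*-monoʳ-≤-≥0 (fromℕ (suc m)) (fromℕ-nonNeg (suc m)) (eventually m M₀≤m C e R))

  branch-thresholds : ∀ {b r} {q : ℕ → ℚ} {δ} → 0ℚ ℚ.< δ →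
                      (∀ i → 1 ≤ i → i ≤ b [] → LiminfAtLeast (branchTree b i) (branchConfig r i) (q i)) →
                      Σ (ℕ → ℕ) (Thresholds b r q δ)
  branch-thresholds {b} {r} {q} {δ} 0<δ liminfᵢ = (λ i → proj₁ (threshold i)) , (λ i → proj₂ (threshold i))
    where
    threshold : ∀ i → ∃[ M₀ ] (1 ≤ i → i ≤ b [] → ∀ n C e → M₀ < n →
                  Run (branchTree b i) (branchConfig r i) n C e → (q i - δ) * fromℕ n ℚ.≤ fromℕ e)
    threshold i with 1 ℕ.≤? i | i ℕ.≤? b []
    ... | yes 1≤i | yes i≤b₀ with liminf-threshold {q = q i} (liminfᵢ i 1≤i i≤b₀) 0<δ
    ...   | M₀ , above = M₀ , λ _ _ → above
    threshold i | no 1≰i  | _        = 0 , λ 1≤i → ⊥-elim (1≰i 1≤i)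
    threshold i | yes _   | no i≰b₀  = 0 , λ _ i≤b₀ → ⊥-elim (i≰b₀ i≤b₀)

  sumTo-bound : ∀ {b r N e} q → (∀ i → 0ℚ ℚ.≤ q i) → ∀ {δ M₀} → (D : Decomposition b r N e) →
                0ℚ ℚ.≤ δ → Thresholds b r q δ M₀ →
                (sumTo (b []) q - fromℕ (b []) * δ) * fromℕ (Decomposition.returned D ∸ 1)
                  ℚ.≤ fromℕ e + sumTo (b []) q * fromℕ (sumToℕ (b []) M₀)
  sumTo-bound {b} {e = e} q q≥0 {δ} {M₀} D 0≤δ thresholds = subst₂ ℚ._≤_
    (trans (sumTo-*ʳ b₀ (λ i → q i - δ) (fromℕ y)) (cong (_* fromℕ y) (sumTo-minus-const b₀ q δ)))
    (trans (sumTo-+ b₀ _ _) (cong₂ _+_ (trans (sumTo-fromℕ b₀ escaped) (cong fromℕ (sym E≡sum))) (sumTo-*ʳ b₀ q (fromℕ M))))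
    (sumTo-mono-≤ b₀ per-branch)
    where
    open Decomposition D
    b₀ M y : ℕ
    b₀ = b []
    M  = sumToℕ b₀ M₀
    y  = returned ∸ 1
    per-branch : ∀ i → 1 ≤ i → i ≤ b₀ → (q i - δ) * fromℕ y ℚ.≤ fromℕ (escaped i) + q i * fromℕ M
    per-branch i 1≤i i≤b₀ =
      escapes-lower-bound (sumToℕ-≥ b₀ M₀ 1≤i i≤b₀) (q≥0 i) 0≤δ (ℕ.∸-monoˡ-≤ 1 (returned≤1+sent i 1≤i i≤b₀))
        (λ M₀<n → thresholds i 1≤i i≤b₀ (sent i) _ (escaped i) M₀<n (proj₂ (branch-run i)))

  escape-rate : ∀ {b r n e} q (q≥0 : ∀ i → 0ℚ ℚ.≤ q i) {δ h M₀} → Decomposition b r (suc n) e →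
                0ℚ ℚ.≤ δ → 0ℚ ℚ.≤ h → fromℕ (b []) * δ ≡ h → Thresholds b r q δ M₀ →
                sumTo (b []) q * (1ℚ + fromℕ (sumToℕ (b []) M₀)) ℚ.≤ h * fromℕ (suc n) →
                bound (sumTo (b []) q) (sumTo-nonneg (b []) q q≥0) - (h + h) ℚ.≤ + e / suc n
  escape-rate {b} {n = n} {e} q q≥0 {δ} {h} {M₀} D 0≤δ 0≤h b₀δ≡h thresholds N-large
    with bound-reciprocal (sumTo (b []) q) (sumTo-nonneg (b []) q q≥0)
  ... | u , bound≡1-u , u[1+S]≡1 , 0≤u , u≤1 =
    ℚ.*-cancelʳ-≤-pos N (subst₂ ℚ._≤_ (cong (λ B → (B - (h + h)) * N) (sym bound≡1-u)) (sym (/-*-cancel e n))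
      (subst (λ N′ → (1ℚ - u - (h + h)) * N′ ℚ.≤ fromℕ e) (sym N≡e+x)
        (escape-fraction {S} {u} {h + h} {fromℕ e} {fromℕ returned} u[1+S]≡1 0≤u u≤1 (*-≥0 (ℚ.+-mono-≤ 0≤h 0≤h) (ℚ.+-mono-≤ (fromℕ-nonNeg e) (fromℕ-nonNeg returned)))
          (subst (λ N′ → S * fromℕ returned ℚ.≤ fromℕ e + (h + h) * N′) N≡e+x
            (returned-bound {S} {h} {fromℕ e} {fromℕ returned} {fromℕ (returned ∸ 1)} {fromℕ (sumToℕ (b []) M₀)} {N} 0≤S 0≤h x≤1+y y≤N summed N-large)))))
    where
    open Decomposition D
    S N : ℚ
    S = sumTo (b []) q
    N = fromℕ (suc n)
    0≤S : 0ℚ ℚ.≤ S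
    0≤S = sumTo-nonneg (b []) q q≥0
    N≡e+x : N ≡ fromℕ e + fromℕ returned
    N≡e+x = trans (cong fromℕ N≡E+returned) (fromℕ-+ e returned)
    x≤1+y : fromℕ returned ℚ.≤ 1ℚ + fromℕ (returned ∸ 1)
    x≤1+y = subst (fromℕ returned ℚ.≤_) (fromℕ-+ 1 (returned ∸ 1)) (fromℕ-mono-≤ (ℕ.m≤n+m∸n returned 1))
    y≤N : fromℕ (returned ∸ 1) ℚ.≤ N
    y≤N = fromℕ-mono-≤ (ℕ.≤-trans (ℕ.m∸n≤m returned 1) (subst (returned ≤_) (sym N≡E+returned) (ℕ.m≤n+m returned e)))
    summed : (S - h) * fromℕ (returned ∸ 1) ℚ.≤ fromℕ e + S * fromℕ (sumToℕ (b []) M₀)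
    summed = subst (λ d → (S - d) * fromℕ (returned ∸ 1) ℚ.≤ _) b₀δ≡h (sumTo-bound q q≥0 D 0≤δ thresholds)

  halves : ∀ p → p ≡ p * ½ + p * ½
  halves = solve 1 (λ p → p := p :* con ½ :+ p :* con ½) refl

  half-pos : ∀ {p} → 0ℚ ℚ.< p → 0ℚ ℚ.< p * ½
  half-pos {p} 0<p = ℚ.positive⁻¹ (p * ½) {{ℚ.pos*pos⇒pos p {{ℚ.positive 0<p}} ½}}

open import Data.Integer using (+_)
open RotorWalk
open Rates

lemma25 : (b : Tree) (r : Config) → Infinite b → IsConfig b r →
          (q : ℕ → ℚ) → (q≥0 : ∀ i → 0ℚ ℚ.≤ q i) →
          (∀ i → 1 ≤ i → i ≤ b [] →
            LiminfAtLeast (branchTree b i) (branchConfig r i) (q i)) →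
          LiminfAtLeast b r (bound (sumTo (b []) q) (sumTo-nonneg (b []) q q≥0))
lemma25 b r inf r-ok q q≥0 liminfᵢ ε 0<ε = proj₁ K , λ n K≤n C e R →
  subst (λ ε′ → β - ε′ ℚ.≤ + e / suc n) (sym (halves ε))
    (escape-rate q q≥0 (Bookkeeping.run-decomposes b r b₀≥1 r-ok R) (ℚ.<⇒≤ (proj₁ (proj₂ δ))) (ℚ.<⇒≤ 0<h)
      (proj₂ (proj₂ δ)) (proj₂ M₀) (proj₂ K (suc n) (ℕ.m≤n⇒m≤1+n K≤n)))
  where
  b₀≥1 : 1 ≤ b []
  b₀≥1 = infinite⇒1≤b₀ b inf
  β h : ℚ
  β = bound (sumTo (b []) q) (sumTo-nonneg (b []) q q≥0)
  h = ε * ½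
  0<h : 0ℚ ℚ.< h
  0<h = half-pos 0<ε
  δ : ∃[ δ ] (0ℚ ℚ.< δ × fromℕ (b []) * δ ≡ h)
  δ = divide-evenly h b₀≥1 0<h
  M₀ : Σ (ℕ → ℕ) (Thresholds b r q (proj₁ δ))
  M₀ = branch-thresholds {b} {r} {q} (proj₁ (proj₂ δ)) liminfᵢ
  K : ∃[ K ] ∀ n → K ≤ n → sumTo (b []) q * (1ℚ ℚ.+ fromℕ (sumToℕ (b []) (proj₁ M₀))) ℚ.≤ h * fromℕ n
  K = eventually-below _ 0<h
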